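{- (1) If $\gamma$ is a closed partial graph, then $\gamma/_{\mathit{reach}\,\gamma\,x}$ is closed for every node $x$. (2) If $\gamma_1\bullet\gamma_2$ is defined and closed, $x\in\mathit{nodes}\ (\gamma_1\bullet\gamma_2)$, and $\mathit{nodes}\ \gamma_1=\mathit{reach}\ (\gamma_1\bullet\gamma_2)\ x$, then $\gamma_1$ is closed, $x\in\mathit{nodes}\ \gamma_1$, and $\mathit{nodes}\ \gamma_1=\mathit{reach}\ \gamma_1\ x$.
   Context: Nodes are natural numbers with $0=\mathrm{null}$. A partial graph of type $T$ is a finite partial map $\gamma$ from nodes to $T\times\mathrm{seq}(\mathrm{node})$, undefined at $\mathrm{null}$; $\mathit{nodes}\ \gamma$ is its domain, $\mathit{nodes}_0\ \gamma=\{\mathrm{null}\}\uplus\mathit{nodes}\ \gamma$, $\gamma_{adj}\,x$ the adjacency list (entries need not be nodes of $\gamma$). $\gamma_1\bullet\gamma_2$ is union of maps with disjoint domains. $\gamma/_S$ is $\gamma$ restricted to $S\cap\mathit{nodes}\ \gamma$. $\gamma\setminus x$ is $\gamma$ restricted to $\mathit{nodes}\ \gamma\setminus\{x\}$. $\mathit{sinks}\ \gamma=\bigcup_{x\in\mathit{nodes}\,\gamma}\gamma_{adj}\,x$; $\gamma$ is closed iff $\mathit{sinks}\ \gamma\subseteq\mathit{nodes}_0\ \gamma$. $\mathit{reach}\ \gamma\ x=\{x\}\cup\bigcup_{z\in\gamma_{adj}x}\mathit{reach}\ (\gamma\setminus x)\ z$ if $x\in\mathit{nodes}\ \gamma$,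 and $\emptyset$ otherwise. -}

module Defs where

open import Data.Nat using (ℕ; zero; suc)
open import Data.Nat.Properties using (_≟_)
open import Data.Product using (_×_; _,_; proj₁; proj₂)
open import Data.Maybe using (Maybe; just; nothing)
open import Data.List using (List; []; _∷_; map; filter; concatMap; length; _++_)
open import Data.List.Membership.Propositional using (_∈_; _∉_)
open import Data.List.Membership.DecPropositional _≟_ using (_∈?_)
open import Data.List.Relation.Binary.Subset.Propositional using (_⊆_)
open import Data.List.Relation.Unary.Unique.Propositional using (Unique)
open import Data.List.Relation.Binary.Disjoint.Propositional using (Disjoint)
open import Relation.Nullary using (¬?; yes; no)

Node : Set
Node = ℕ

null : Node
null = 0

-- A (raw) partial graph of type T: a finite association list
-- node ↦ (label , adjacency list).
Graph : Set → Set
Graph T = List (Node × T × List Node)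

nodes : ∀ {T} → Graph T → List Node
nodes γ = map proj₁ γ

nodes₀ : ∀ {T} → Graph T → List Node
nodes₀ γ = null ∷ nodes γ

IsPGraph : ∀ {T} → Graph T → Set
IsPGraph γ = Unique (nodes γ) × null ∉ nodes γ

-- adjacency list of x (empty if x is not a node)
adj : ∀ {T} → Graph T → Node → List Node
adj [] x = []
adj ((y , _ , ys) ∷ γ) x with y ≟ x
... | yes _ = ys
... | no  _ = adj γ x

-- γ₁ • γ₂ : union of maps (defined when domains are disjoint)
_•_ : ∀ {T} → Graph T → Graph T → Graph T
γ₁ • γ₂ = γ₁ ++ γ₂

Defined• : ∀ {T} → Graph T → Graph T → Set
Defined• γ₁ γ₂ = Disjoint (nodes γ₁) (nodes γ₂)

restrict : ∀ {T} → Graph T → List Node → Graph T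
restrict γ S = filter (λ e → proj₁ e ∈? S) γ

_∖_ : ∀ {T} → Graph T → Node → Graph T
γ ∖ x = filter (λ e → ¬? (proj₁ e ≟ x)) γ

sinks : ∀ {T} → Graph T → List Node
sinks γ = concatMap (adj γ) (nodes γ)

Closed : ∀ {T} → Graph T → Set
Closed γ = sinks γ ⊆ nodes₀ γ

-- reach, computed with fuel; fuel = number of entries suffices since
-- every recursive call removes the (present) node x from the graph.
reachF : ∀ {T} → ℕ → Graph T → Node → List Node
reachF zero γ x = []
reachF (suc n) γ x with x ∈? nodes γ
... | yes _ = x ∷ concatMap (reachF n (γ ∖ x)) (adj γ x)
... | no  _ = []

reach : ∀ {T} → Graph T → Node → List Node
reach γ x = reachF (length γ) γ x

_≐_ : List Node → List Node → Set
A ≐ B = A ⊆ B × B ⊆ A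

-- The reachable set reach γ x is the least set containing x (if x is a node) that is closed
-- under the edges of γ.  Restricting a closed graph to any edge-closed set of nodes keeps it
-- closed, which gives (1).  For (2), nodes γ₁ = reach (γ₁ • γ₂) x is edge-closed in γ₁ • γ₂,
-- so γ₁ is closed; and reach γ₁ x, being edge-closed in γ₁ ⊆ γ₁ • γ₂, is edge-closed in
-- γ₁ • γ₂ as well, so by minimality it contains reach (γ₁ • γ₂) x = nodes γ₁.
module Submission where

open import Defs
open import Data.Nat using (zero; suc; _≤_; _<_)
open import Data.Nat.Properties using (_≟_; ≤-refl; ≤-trans; ≤-pred)
open import Data.Product using (_×_; _,_; proj₁; proj₂; ∃-syntax)
open import Data.Sum using (_⊎_; inj₁; inj₂)
open import Data.List using (List; []; _∷_; filter; length; _++_)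
open import Data.List.Properties using (map-++; filter-notAll)
open import Data.List.Relation.Unary.Any using (here; there)
open import Data.List.Membership.Propositional using (_∈_; find; lose)
open import Data.List.Membership.Propositional.Properties
  using (∈-map⁺; ∈-map⁻; ∈-filter⁺; ∈-filter⁻; ∈-++⁺ˡ; ∈-concatMap⁺; ∈-concatMap⁻)
open import Data.List.Membership.DecPropositional _≟_ using (_∈?_)
open import Data.List.Relation.Binary.Subset.Propositional using (_⊆_)
open import Data.Empty using (⊥-elim)
open import Function using (_∘_)
open import Relation.Nullary using (¬_; ¬?; yes; no)
open import Relation.Unary using (Decidable)
open import Relation.Binary.PropositionalEquality using (_≡_; refl; sym; subst)

private
  variable
    T : Set
    γ γ′ : Graph T
    S : List Node

infix 4 _⊑_

record _⊑_ (γ′ γ : Graph T) : Set where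
  field
    nodes-⊆ : nodes γ′ ⊆ nodes γ
    adj-≡   : ∀ {y} → y ∈ nodes γ′ → adj γ′ y ≡ adj γ y

open _⊑_

EdgeClosed : Graph T → List Node → Set
EdgeClosed γ S = ∀ {y z} → y ∈ S → y ∈ nodes γ → z ∈ adj γ y → z ∈ nodes γ → z ∈ S

EdgeClosed-resp-≐ : {S′ : List Node} → S ≐ S′ → EdgeClosed γ S → EdgeClosed γ S′
EdgeClosed-resp-≐ (S⊆S′ , S′⊆S) closed y∈S′ y∈γ z∈adj z∈γ = S⊆S′ (closed (S′⊆S y∈S′) y∈γ z∈adj z∈γ)

EdgeClosed-⊑ : γ′ ⊑ γ → EdgeClosed γ S → EdgeClosed γ′ S
EdgeClosed-⊑ γ′⊑γ closed y∈S y∈γ′ z∈adj z∈γ′ =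
  closed y∈S (nodes-⊆ γ′⊑γ y∈γ′) (subst (_ ∈_) (adj-≡ γ′⊑γ y∈γ′) z∈adj) (nodes-⊆ γ′⊑γ z∈γ′)

EdgeClosed-lift : γ′ ⊑ γ → EdgeClosed γ (nodes γ′) → S ⊆ nodes γ′ →
                  EdgeClosed γ′ S → EdgeClosed γ S
EdgeClosed-lift γ′⊑γ γ′-closed S⊆γ′ closed y∈S y∈γ z∈adj z∈γ =
  closed y∈S y∈γ′ z∈adj′ (γ′-closed y∈γ′ y∈γ z∈adj z∈γ)
  where
  y∈γ′ = S⊆γ′ y∈S
  z∈adj′ = subst (_ ∈_) (sym (adj-≡ γ′⊑γ y∈γ′)) z∈adj

Closed-edge : Closed γ → ∀ {y z} → y ∈ nodes γ → z ∈ adj γ y → z ∈ nodes₀ γ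
Closed-edge {γ = γ} closed y∈γ z∈adj = closed (∈-concatMap⁺ (adj γ) (lose y∈γ z∈adj))

Closed-⊑ : γ′ ⊑ γ → Closed γ → EdgeClosed γ (nodes γ′) → Closed γ′
Closed-⊑ {γ′ = γ′} γ′⊑γ closed γ′-closed z∈sinks
  with y , y∈γ′ , z∈adj′ ← find (∈-concatMap⁻ (adj γ′) z∈sinks)
  with z∈adj ← subst (_ ∈_) (adj-≡ γ′⊑γ y∈γ′) z∈adj′
  with Closed-edge closed (nodes-⊆ γ′⊑γ y∈γ′) z∈adj
... | here z≡null = here z≡null
... | there z∈γ   = there (γ′-closed y∈γ′ (nodes-⊆ γ′⊑γ y∈γ′) z∈adj z∈γ)

module _ {P : Node → Set} (P? : Decidable P) where

  filterᵏ : Graph T → Graph T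
  filterᵏ = filter (P? ∘ proj₁)

  ∈-nodes-filterᵏ⁻ : (γ : Graph T) → ∀ {y} → y ∈ nodes (filterᵏ γ) → y ∈ nodes γ × P y
  ∈-nodes-filterᵏ⁻ γ y∈
    with _ , e∈ , refl ← ∈-map⁻ proj₁ y∈
    with e∈γ , Pe ← ∈-filter⁻ (P? ∘ proj₁) e∈ = ∈-map⁺ proj₁ e∈γ , Pe

  ∈-nodes-filterᵏ⁺ : (γ : Graph T) → ∀ {y} → y ∈ nodes γ → P y → y ∈ nodes (filterᵏ γ)
  ∈-nodes-filterᵏ⁺ γ y∈ Py with _ , e∈ , refl ← ∈-map⁻ proj₁ y∈ =
    ∈-map⁺ proj₁ (∈-filter⁺ (P? ∘ proj₁) e∈ Py)

  adj-filterᵏ : (γ : Graph T) → ∀ {y} → P y → adj (filterᵏ γ) y ≡ adj γ y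
  adj-filterᵏ [] Py = refl
  adj-filterᵏ ((k , _ , _) ∷ γ) {y} Py with P? k
  ... | yes _ with k ≟ y
  ...   | yes _ = refl
  ...   | no _  = adj-filterᵏ γ Py
  adj-filterᵏ ((k , _ , _) ∷ γ) {y} Py | no ¬Pk with k ≟ y
  ...   | yes refl = ⊥-elim (¬Pk Py)
  ...   | no _     = adj-filterᵏ γ Py

  filterᵏ-⊑ : (γ : Graph T) → filterᵏ γ ⊑ γ
  filterᵏ-⊑ γ = record
    { nodes-⊆ = proj₁ ∘ ∈-nodes-filterᵏ⁻ γ
    ; adj-≡   = adj-filterᵏ γ ∘ proj₂ ∘ ∈-nodes-filterᵏ⁻ γ
    }

  length-filterᵏ-< : (γ : Graph T) → ∀ {y} → y ∈ nodes γ → ¬ P y → length (filterᵏ γ) < length γ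
  length-filterᵏ-< γ y∈ ¬Py with _ , e∈ , refl ← ∈-map⁻ proj₁ y∈ =
    filter-notAll (P? ∘ proj₁) γ (lose e∈ ¬Py)

restrict-EdgeClosed : EdgeClosed γ S → EdgeClosed γ (nodes (restrict γ S))
restrict-EdgeClosed {γ = γ} {S = S} closed y∈ y∈γ z∈adj z∈γ =
  ∈-nodes-filterᵏ⁺ (_∈? S) γ z∈γ (closed (proj₂ (∈-nodes-filterᵏ⁻ (_∈? S) γ y∈)) y∈γ z∈adj z∈γ)

restrict-Closed : Closed γ → EdgeClosed γ S → Closed (restrict γ S)
restrict-Closed {γ = γ} {S = S} closed S-closed =
  Closed-⊑ (filterᵏ-⊑ (_∈? S) γ) closed (restrict-EdgeClosed S-closed)

adj-++ : (γ₁ γ₂ : Graph T) → ∀ {y} → y ∈ nodes γ₁ → adj (γ₁ ++ γ₂) y ≡ adj γ₁ y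
adj-++ ((k , _ , _) ∷ γ₁) γ₂ {y} y∈ with k ≟ y | y∈
... | yes _  | _         = refl
... | no k≢y | here refl = ⊥-elim (k≢y refl)
... | no _   | there y∈′ = adj-++ γ₁ γ₂ y∈′

++-⊑ : (γ₁ γ₂ : Graph T) → γ₁ ⊑ γ₁ • γ₂
++-⊑ γ₁ γ₂ = record
  { nodes-⊆ = subst (_ ∈_) (sym (map-++ proj₁ γ₁ γ₂)) ∘ ∈-++⁺ˡ
  ; adj-≡   = sym ∘ adj-++ γ₁ γ₂
  }

∖-⊑ : (γ : Graph T) (x : Node) → γ ∖ x ⊑ γ
∖-⊑ γ x = filterᵏ-⊑ (λ k → ¬? (k ≟ x)) γ

∈-nodes-∖⁺ : (γ : Graph T) → ∀ {x y} → y ∈ nodes γ → ¬ y ≡ x → y ∈ nodes (γ ∖ x)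
∈-nodes-∖⁺ γ {x} = ∈-nodes-filterᵏ⁺ (λ k → ¬? (k ≟ x)) γ

length-∖-< : (γ : Graph T) → ∀ {x} → x ∈ nodes γ → length (γ ∖ x) < length γ
length-∖-< γ {x} x∈ = length-filterᵏ-< (λ k → ¬? (k ≟ x)) γ x∈ (λ x≢x → x≢x refl)

∈-reachF-suc⁻ : ∀ n (γ : Graph T) x {y} → y ∈ reachF (suc n) γ x →
                x ∈ nodes γ × (y ≡ x ⊎ ∃[ w ] w ∈ adj γ x × y ∈ reachF n (γ ∖ x) w)
∈-reachF-suc⁻ n γ x y∈ with x ∈? nodes γ | y∈
... | yes x∈γ | here y≡x  = x∈γ , inj₁ y≡x
... | yes x∈γ | there y∈′ = x∈γ , inj₂ (find (∈-concatMap⁻ (reachF n (γ ∖ x)) {adj γ x} y∈′))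

∈-reachF-suc⁺ : ∀ n (γ : Graph T) {x w y} → x ∈ nodes γ → w ∈ adj γ x →
                y ∈ reachF n (γ ∖ x) w → y ∈ reachF (suc n) γ x
∈-reachF-suc⁺ n γ {x} x∈γ w∈adj y∈ with x ∈? nodes γ
... | yes _   = there (∈-concatMap⁺ (reachF n (γ ∖ x)) (lose w∈adj y∈))
... | no x∉γ  = ⊥-elim (x∉γ x∈γ)

reachF-self : ∀ n (γ : Graph T) {x} → x ∈ nodes γ → length γ ≤ n → x ∈ reachF n γ x
reachF-self (suc n) γ {x} x∈γ _ with x ∈? nodes γ
... | yes _   = here refl
... | no x∉γ  = ⊥-elim (x∉γ x∈γ)
reachF-self zero (_ ∷ _) _ ()

reachF-⊆-nodes : ∀ n (γ : Graph T) x → reachF n γ x ⊆ nodes γ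
reachF-⊆-nodes (suc n) γ x y∈ with ∈-reachF-suc⁻ n γ x y∈
... | x∈γ , inj₁ refl             = x∈γ
... | _   , inj₂ (w , _ , y∈reach) = nodes-⊆ (∖-⊑ γ x) (reachF-⊆-nodes n (γ ∖ x) w y∈reach)

length-∖-≤-pred : (γ : Graph T) → ∀ {x n} → x ∈ nodes γ → length γ ≤ suc n →
                  length (γ ∖ x) ≤ n
length-∖-≤-pred γ x∈γ fuel = ≤-pred (≤-trans (length-∖-< γ x∈γ) fuel)

reachF-EdgeClosed : ∀ n (γ : Graph T) x → length γ ≤ n → EdgeClosed γ (reachF n γ x)
reachF-EdgeClosed (suc n) γ x fuel {y} {z} y∈reach y∈γ z∈adj z∈γ
  with z ≟ x | ∈-reachF-suc⁻ n γ x y∈reach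
... | yes refl | x∈γ , _ = reachF-self (suc n) γ x∈γ fuel
... | no z≢x   | x∈γ , inj₁ refl =
  ∈-reachF-suc⁺ n γ x∈γ z∈adj
    (reachF-self n (γ ∖ x) (∈-nodes-∖⁺ γ z∈γ z≢x) (length-∖-≤-pred γ x∈γ fuel))
... | no z≢x   | x∈γ , inj₂ (w , w∈adj , y∈reach′) =
  ∈-reachF-suc⁺ n γ x∈γ w∈adj
    (reachF-EdgeClosed n (γ ∖ x) w (length-∖-≤-pred γ x∈γ fuel) y∈reach′ y∈γ∖x
      (subst (z ∈_) (sym (adj-≡ (∖-⊑ γ x) y∈γ∖x)) z∈adj) (∈-nodes-∖⁺ γ z∈γ z≢x))
  where y∈γ∖x = reachF-⊆-nodes n (γ ∖ x) w y∈reach′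

reachF-least : ∀ n (γ : Graph T) x → (x ∈ nodes γ → x ∈ S) → EdgeClosed γ S →
               reachF n γ x ⊆ S
reachF-least (suc n) γ x x∈S closed y∈ with ∈-reachF-suc⁻ n γ x y∈
... | x∈γ , inj₁ refl = x∈S x∈γ
... | x∈γ , inj₂ (w , w∈adj , y∈reach) =
  reachF-least n (γ ∖ x) w
    (λ w∈γ∖x → closed (x∈S x∈γ) x∈γ w∈adj (nodes-⊆ (∖-⊑ γ x) w∈γ∖x))
    (EdgeClosed-⊑ (∖-⊑ γ x) closed) y∈reach

reach-⊆-nodes : (γ : Graph T) (x : Node) → reach γ x ⊆ nodes γ
reach-⊆-nodes γ = reachF-⊆-nodes (length γ) γ

reach-self : (γ : Graph T) {x : Node} → x ∈ nodes γ → x ∈ reach γ x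
reach-self γ x∈γ = reachF-self (length γ) γ x∈γ ≤-refl

reach-EdgeClosed : (γ : Graph T) (x : Node) → EdgeClosed γ (reach γ x)
reach-EdgeClosed γ x = reachF-EdgeClosed (length γ) γ x ≤-refl

reach-least : (γ : Graph T) (x : Node) → (x ∈ nodes γ → x ∈ S) → EdgeClosed γ S →
              reach γ x ⊆ S
reach-least γ = reachF-least (length γ) γ

lemma3p5 : (∀ {T : Set} (γ : Graph T) → IsPGraph γ → Closed γ →
    ∀ (x : Node) → Closed (restrict γ (reach γ x)))
    ×
    (∀ {T : Set} (γ₁ γ₂ : Graph T) → IsPGraph γ₁ → IsPGraph γ₂ →
    Defined• γ₁ γ₂ → Closed (γ₁ • γ₂) →
    ∀ (x : Node) → x ∈ nodes (γ₁ • γ₂) → nodes γ₁ ≐ reach (γ₁ • γ₂) x →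
    Closed γ₁ × x ∈ nodes γ₁ × nodes γ₁ ≐ reach γ₁ x)
lemma3p5 =
  (λ γ _ closed x → restrict-Closed closed (reach-EdgeClosed γ x)) ,
  (λ γ₁ γ₂ _ _ _ closed x x∈γ (γ₁⊆R , R⊆γ₁) →
    let γ = γ₁ • γ₂
        x∈γ₁ = R⊆γ₁ (reach-self γ x∈γ)
        γ₁-closed = EdgeClosed-resp-≐ (R⊆γ₁ , γ₁⊆R) (reach-EdgeClosed γ x)
        reach₁-closed = EdgeClosed-lift (++-⊑ γ₁ γ₂) γ₁-closed
                          (reach-⊆-nodes γ₁ x) (reach-EdgeClosed γ₁ x)
    in Closed-⊑ (++-⊑ γ₁ γ₂) closed γ₁-closed ,
       x∈γ₁ ,
       reach-least γ x (λ _ → reach-self γ₁ x∈γ₁) reach₁-closed ∘ γ₁⊆R ,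
       reach-⊆-nodes γ₁ x)
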